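{- Let $\mathcal{A}$ be a d-class of subsets of a set $\Omega$. The collection of all ddd sets (with respect to $\mathcal{A}$) is a ring of sets; indeed, it is the ring of sets generated by $\mathcal{A}$.
   Context: A ring of sets is a collection of subsets closed under taking differences and finite unions; the ring generated by a collection is the smallest ring containing it. A collection $\mathcal{A}$ of subsets of $\Omega$ is a d-class if it contains the empty set and, whenever $A,B\in\mathcal{A}$ have non-empty intersection, both $A\cap B$ and $A\cup B$ belong to $\mathcal{A}$; elements of $\mathcal{A}$ are called d sets. A dd set is a set of the form $A\setminus\bigsqcup_{i=1}^nA_i$ where $A,A_1,\dots,A_n$ are d sets with $A_i\subseteq A$ and the $A_i$ pairwise disjoint. A ddd set is a finite disjoint union of dd sets. -}

module Defs where

open import Data.Nat using (ℕ)
open import Data.Fin using (Fin)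
open import Data.Product using (Σ; ∃; ∃-syntax; _×_; _,_)
open import Data.Sum using (_⊎_)
open import Data.Empty using (⊥)
open import Relation.Nullary using (¬_)
open import Relation.Binary.PropositionalEquality using (_≢_)

-- Subsets of Ω are predicates on Ω; equality of subsets is extensional (≐).
Subset : Set → Set₁
Subset Ω = Ω → Set

Collection : Set → Set₂
Collection Ω = Subset Ω → Set₁

module _ {Ω : Set} where

  ∅ : Subset Ω
  ∅ _ = ⊥

  _∩_ : Subset Ω → Subset Ω → Subset Ω
  (A ∩ B) x = A x × B x

  _∪_ : Subset Ω → Subset Ω → Subset Ω
  (A ∪ B) x = A x ⊎ B x

  _∖_ : Subset Ω → Subset Ω → Subset Ω
  (A ∖ B) x = A x × ¬ B x

  ⋃ : {n : ℕ} → (Fin n → Subset Ω) → Subset Ω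
  ⋃ F x = ∃[ i ] F i x

  _⊆_ : Subset Ω → Subset Ω → Set
  A ⊆ B = ∀ x → A x → B x

  _≐_ : Subset Ω → Subset Ω → Set
  A ≐ B = (A ⊆ B) × (B ⊆ A)

  NonEmpty : Subset Ω → Set
  NonEmpty A = ∃[ x ] A x

  PairwiseDisjoint : {n : ℕ} → (Fin n → Subset Ω) → Set
  PairwiseDisjoint F = ∀ i j → i ≢ j → ∀ x → F i x → F j x → ⊥

  _⊑_ : Collection Ω → Collection Ω → Set₁
  𝒜 ⊑ ℬ = ∀ A → 𝒜 A → ℬ A

  -- the collection is a collection of sets: membership respects set equality
  RespectsEq : Collection Ω → Set₁
  RespectsEq 𝒜 = ∀ A B → A ≐ B → 𝒜 A → 𝒜 B

  -- ring of sets: closed under differences and finite unions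
  -- (the empty union gives ∅, binary unions give all finite unions)
  record IsRing (ℛ : Collection Ω) : Set₁ where
    field
      respects : RespectsEq ℛ
      empty    : ℛ ∅
      union    : ∀ A B → ℛ A → ℛ B → ℛ (A ∪ B)
      diff     : ∀ A B → ℛ A → ℛ B → ℛ (A ∖ B)

  record IsDClass (𝒜 : Collection Ω) : Set₁ where
    field
      respects : RespectsEq 𝒜
      empty    : 𝒜 ∅
      inter    : ∀ A B → 𝒜 A → 𝒜 B → NonEmpty (A ∩ B) → 𝒜 (A ∩ B)
      union    : ∀ A B → 𝒜 A → 𝒜 B → NonEmpty (A ∩ B) → 𝒜 (A ∪ B)

  DD : Collection Ω → Collection Ω
  DD 𝒜 X = Σ (Subset Ω) λ A → Σ ℕ λ n → Σ (Fin n → Subset Ω) λ F →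
      𝒜 A × (∀ i → 𝒜 (F i)) × (∀ i → F i ⊆ A) × PairwiseDisjoint F
    × (X ≐ (A ∖ ⋃ F))

  DDD : Collection Ω → Collection Ω
  DDD 𝒜 X = Σ ℕ λ m → Σ (Fin m → Subset Ω) λ G →
      (∀ k → DD 𝒜 (G k)) × PairwiseDisjoint G × (X ≐ ⋃ G)

  IsGeneratedRing : Collection Ω → Collection Ω → Set₂
  IsGeneratedRing 𝒜 ℛ = IsRing ℛ × (𝒜 ⊑ ℛ)
    × (∀ (𝒮 : Collection Ω) → IsRing 𝒮 → 𝒜 ⊑ 𝒮 → ℛ ⊑ 𝒮)

-- The dd sets form a semiring, and finite disjoint unions of the members of a semiring form a
-- ring. The key fact is that A ∖ (B₁ ∪ … ∪ Bₖ) is a dd set for all d sets A, Bᵢ: the Bᵢ may be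
-- replaced by the d sets A ∩ Bᵢ, and a finite union of d sets is a disjoint union of d sets,
-- because two d sets that meet merge into a d set. From this, (A ∖ ⋃F) ∩ (B ∖ ⋃E) is the dd set
-- (A ∩ B) ∖ ⋃(F, E), and X ∖ (B ∖ ⋃E) is the disjoint union of the dd set X ∖ B with X ∩ ⋃E.
-- Conversely every ring containing the d sets contains each A ∖ ⋃F, hence every ddd set.

module Submission where

open import Defs
open import Level using (suc; zero; 0ℓ; lift; lower)
open import Axiom.ExcludedMiddle using (ExcludedMiddle)
open import Data.Product using (_×_; Σ; _,_; proj₁; proj₂)
open import Data.Nat using (ℕ)
open import Data.Fin using (Fin; splitAt; _↑ˡ_; _↑ʳ_; _≟_)
open import Data.Fin.Properties using (splitAt⁻¹-↑ˡ; splitAt⁻¹-↑ʳ; suc-injective)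
open import Data.Vec.Functional using ([]; _∷_; _++_; head; tail)
open import Data.Vec.Functional.Properties using (lookup-++ˡ; lookup-++ʳ)
open import Data.Vec.Functional.Relation.Unary.All.Properties using (++⁺)
open import Data.Sum using (inj₁; inj₂)
import Data.Sum
open import Data.Empty using (⊥; ⊥-elim)
open import Function using (flip; _∘_)
open import Relation.Nullary using (¬_; yes; no)
open import Relation.Nullary.Decidable using (map′)
open import Relation.Binary.PropositionalEquality using (refl; sym; trans; cong; subst)

lowerExcludedMiddle : ∀ {ℓ} → ExcludedMiddle (suc ℓ) → ExcludedMiddle ℓ
lowerExcludedMiddle em = map′ lower lift em

module _ {Ω : Set} where

  private
    variable
      m n : ℕ
      X X′ Y Y′ Z : Subset Ω
      F G : Fin n → Subset Ω

  ≐-refl : X ≐ X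
  ≐-refl = (λ _ p → p) , (λ _ p → p)

  ≐-sym : X ≐ Y → Y ≐ X
  ≐-sym (X⊆Y , Y⊆X) = Y⊆X , X⊆Y

  ≐-trans : X ≐ Y → Y ≐ Z → X ≐ Z
  ≐-trans (X⊆Y , Y⊆X) (Y⊆Z , Z⊆Y) = (λ x p → Y⊆Z x (X⊆Y x p)) , (λ x p → Y⊆X x (Z⊆Y x p))

  ∪-cong : X ≐ X′ → Y ≐ Y′ → (X ∪ Y) ≐ (X′ ∪ Y′)
  ∪-cong (X⊆ , ⊆X) (Y⊆ , ⊆Y) = (λ x → Data.Sum.map (X⊆ x) (Y⊆ x))
                            , (λ x → Data.Sum.map (⊆X x) (⊆Y x))

  ∩-cong : X ≐ X′ → Y ≐ Y′ → (X ∩ Y) ≐ (X′ ∩ Y′)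
  ∩-cong (X⊆ , ⊆X) (Y⊆ , ⊆Y) = (λ { x (p , q) → X⊆ x p , Y⊆ x q })
                            , (λ { x (p , q) → ⊆X x p , ⊆Y x q })

  ∖-cong : X ≐ X′ → Y ≐ Y′ → (X ∖ Y) ≐ (X′ ∖ Y′)
  ∖-cong (X⊆ , ⊆X) (Y⊆ , ⊆Y) = (λ { x (p , q) → X⊆ x p , (λ r → q (⊆Y x r)) })
                            , (λ { x (p , q) → ⊆X x p , (λ r → q (Y⊆ x r)) })

  ∖-∩-∖ : ((X ∖ X′) ∩ (Y ∖ Y′)) ≐ ((X ∩ Y) ∖ (X′ ∪ Y′))
  ∖-∩-∖ = (λ { x ((p , p′) , (q , q′)) → (p , q) , Data.Sum.[ p′ , q′ ] })
        , (λ { x ((p , q) , r) → (p , r ∘ inj₁) , (q , r ∘ inj₂) })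

  ∖-∖ : ExcludedMiddle 0ℓ → Z ⊆ Y → (X ∖ (Y ∖ Z)) ≐ ((X ∖ Y) ∪ (X ∩ Z))
  ∖-∖ {Z} {Y} {X} em Z⊆Y = to , from
    where
    to : (X ∖ (Y ∖ Z)) ⊆ ((X ∖ Y) ∪ (X ∩ Z))
    to x (p , q) with em {Y x} | em {Z x}
    ... | no ¬y | _ = inj₁ (p , ¬y)
    ... | yes _ | yes z = inj₂ (p , z)
    ... | yes y | no ¬z = ⊥-elim (q (y , ¬z))
    from : ((X ∖ Y) ∪ (X ∩ Z)) ⊆ (X ∖ (Y ∖ Z))
    from x (inj₁ (p , ¬y)) = p , (λ r → ¬y (proj₁ r))
    from x (inj₂ (p , z)) = p , (λ r → proj₂ r z)

  ∖-∪-cancel : ExcludedMiddle 0ℓ → ((X ∖ Y) ∪ Y) ≐ (X ∪ Y)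
  ∖-∪-cancel {X} {Y} em = (λ x → Data.Sum.map₁ proj₁) , from
    where
    from : (X ∪ Y) ⊆ ((X ∖ Y) ∪ Y)
    from x (inj₂ q) = inj₂ q
    from x (inj₁ p) with em {Y x}
    ... | yes q = inj₂ q
    ... | no ¬q = inj₁ (p , ¬q)

  Disjoint : Subset Ω → Subset Ω → Set
  Disjoint X Y = ∀ x → X x → Y x → ⊥

  ⋃-[] : (F : Fin 0 → Subset Ω) → ⋃ F ≐ ∅
  ⋃-[] F = (λ { _ (() , _) }) , (λ _ ())

  ⋃-uncons : (F : Fin (ℕ.suc n) → Subset Ω) → ⋃ F ≐ (head F ∪ ⋃ (tail F))
  ⋃-uncons F = to , from
    where
    to : ⋃ F ⊆ (head F ∪ ⋃ (tail F))
    to x (Fin.zero , p) = inj₁ p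
    to x (Fin.suc i , p) = inj₂ (i , p)
    from : (head F ∪ ⋃ (tail F)) ⊆ ⋃ F
    from x (inj₁ p) = Fin.zero , p
    from x (inj₂ (i , p)) = Fin.suc i , p

  ⋃-++ : (F : Fin m → Subset Ω) (G : Fin n → Subset Ω) → ⋃ (F ++ G) ≐ (⋃ F ∪ ⋃ G)
  ⋃-++ {m} {n} F G = to , from
    where
    to : ⋃ (F ++ G) ⊆ (⋃ F ∪ ⋃ G)
    to x (k , p) with splitAt m k
    ... | inj₁ i = inj₁ (i , p)
    ... | inj₂ j = inj₂ (j , p)
    from : (⋃ F ∪ ⋃ G) ⊆ ⋃ (F ++ G)
    from x (inj₁ (i , p)) = i ↑ˡ n , subst (λ A → A x) (sym (lookup-++ˡ F G i)) p
    from x (inj₂ (j , p)) = m ↑ʳ j , subst (λ A → A x) (sym (lookup-++ʳ F G j)) p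

  ++-disjoint : PairwiseDisjoint F → PairwiseDisjoint G → (∀ i j → Disjoint (F i) (G j))
              → PairwiseDisjoint (F ++ G)
  ++-disjoint {m} F-disj G-disj FG-disj k l k≢l x
    with splitAt m k in eqₖ | splitAt m l in eqₗ
  ... | inj₁ i | inj₁ j =
    F-disj i j (λ { refl → k≢l (trans (sym (splitAt⁻¹-↑ˡ eqₖ)) (splitAt⁻¹-↑ˡ eqₗ)) }) x
  ... | inj₁ i | inj₂ j = FG-disj i j x
  ... | inj₂ i | inj₁ j = flip (FG-disj j i x)
  ... | inj₂ i | inj₂ j =
    G-disj i j (λ { refl → k≢l (trans (sym (splitAt⁻¹-↑ʳ eqₖ)) (splitAt⁻¹-↑ʳ eqₗ)) }) x

  ∷-disjoint : (∀ i → Disjoint X (F i)) → PairwiseDisjoint F → PairwiseDisjoint (X ∷ F)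
  ∷-disjoint X-disj F-disj Fin.zero Fin.zero 0≢0 = ⊥-elim (0≢0 refl)
  ∷-disjoint X-disj F-disj Fin.zero (Fin.suc j) _ = X-disj j
  ∷-disjoint X-disj F-disj (Fin.suc i) Fin.zero _ x p q = X-disj i x q p
  ∷-disjoint X-disj F-disj (Fin.suc i) (Fin.suc j) i≢j = F-disj i j (λ i≡j → i≢j (cong Fin.suc i≡j))

  tail-disjoint : {F : Fin (ℕ.suc n) → Subset Ω} → PairwiseDisjoint F → PairwiseDisjoint (tail F)
  tail-disjoint F-disj i j i≢j = F-disj (Fin.suc i) (Fin.suc j) (λ e → i≢j (suc-injective e))

  disjoint-⊆ : PairwiseDisjoint F → (∀ i → G i ⊆ F i) → PairwiseDisjoint G
  disjoint-⊆ F-disj G⊆F i j i≢j x p q = F-disj i j i≢j x (G⊆F i x p) (G⊆F j x q)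

  ∩-⋃ʳ : X ≐ ⋃ F → (X ∩ Y) ≐ ⋃ (λ i → F i ∩ Y)
  ∩-⋃ʳ (X⊆ , ⊆X) = (λ { x (p , q) → let (i , r) = X⊆ x p in i , r , q })
                 , (λ { x (i , r , q) → ⊆X x (i , r) , q })

  ∩-⋃ˡ : Y ≐ ⋃ F → (X ∩ Y) ≐ ⋃ (λ i → X ∩ F i)
  ∩-⋃ˡ (Y⊆ , ⊆Y) = (λ { x (p , q) → let (i , r) = Y⊆ x q in i , p , r })
                 , (λ { x (i , p , r) → p , ⊆Y x (i , r) })

  ∖-⋃ʳ : X ≐ ⋃ F → Y ≐ Z → (X ∖ Y) ≐ ⋃ (λ i → F i ∖ Z)
  ∖-⋃ʳ (X⊆ , ⊆X) (Y⊆ , ⊆Y) = (λ { x (p , q) → let (i , r) = X⊆ x p in i , r , (λ z → q (⊆Y x z)) })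
                           , (λ { x (i , r , q) → ⊆X x (i , r) , (λ y → q (Y⊆ x y)) })

  ∖-⋃-uncons : (F : Fin (ℕ.suc n) → Subset Ω) → ((X ∖ head F) ∩ (X ∖ ⋃ (tail F))) ≐ (X ∖ ⋃ F)
  ∖-⋃-uncons F =
      (λ { x ((p , q) , (_ , r)) → p , λ { (Fin.zero , s) → q s ; (Fin.suc i , s) → r (i , s) } })
    , (λ { x (p , q) → (p , (λ s → q (Fin.zero , s))) , (p , (λ { (i , s) → q (Fin.suc i , s) })) })

  ∖-⋃-∷ : ((X ∖ ⋃ F) ∖ Y) ≐ (X ∖ ⋃ (Y ∷ F))
  ∖-⋃-∷ = (λ { x ((p , q) , r) → p , λ { (Fin.zero , y) → r y ; (Fin.suc i , s) → q (i , s) } })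
        , (λ { x (p , q) → (p , (λ { (i , s) → q (Fin.suc i , s) })) , (λ y → q (Fin.zero , y)) })

  ⋃-closed : {ℛ : Collection Ω} → IsRing ℛ →
             ∀ {n} {F : Fin n → Subset Ω} → (∀ i → ℛ (F i)) → ℛ (⋃ F)
  ⋃-closed ring {ℕ.zero} {F} _ = respects ∅ (⋃ F) (≐-sym (⋃-[] F)) empty
    where open IsRing ring
  ⋃-closed ring {ℕ.suc n} {F} F∈ =
    respects _ (⋃ F) (≐-sym (⋃-uncons F))
      (union _ _ (F∈ Fin.zero) (⋃-closed ring (λ i → F∈ (Fin.suc i))))
    where open IsRing ring

-- DDD 𝒜 is definitionally DisjointUnions (DD 𝒜).
DisjointUnions : {Ω : Set} → Collection Ω → Collection Ω
DisjointUnions 𝒫 X = Σ ℕ λ m → Σ (Fin m → Subset _) λ G →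
  (∀ k → 𝒫 (G k)) × PairwiseDisjoint G × (X ≐ ⋃ G)

module DisjointUnionsOf {Ω : Set} (𝒫 : Collection Ω) where

  private
    variable
      P X Y : Subset Ω

  respects : RespectsEq (DisjointUnions 𝒫)
  respects X Y X≐Y (m , G , G∈ , G-disj , X≐) = m , G , G∈ , G-disj , ≐-trans (≐-sym X≐Y) X≐

  empty : DisjointUnions 𝒫 ∅
  empty = 0 , [] , (λ ()) , (λ ()) , ≐-sym (⋃-[] [])

  singleton : 𝒫 X → DisjointUnions 𝒫 X
  singleton {X} X∈ = 1 , (λ _ → X) , (λ _ → X∈) , single-disjoint
                   , (λ _ p → Fin.zero , p) , (λ _ → proj₂)
    where
    single-disjoint : PairwiseDisjoint (λ (_ : Fin 1) → X)
    single-disjoint Fin.zero Fin.zero 0≢0 = ⊥-elim (0≢0 refl)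

  ∪-disjoint : DisjointUnions 𝒫 X → DisjointUnions 𝒫 Y → Disjoint X Y → DisjointUnions 𝒫 (X ∪ Y)
  ∪-disjoint (m , G , G∈ , G-disj , X≐) (n , H , H∈ , H-disj , Y≐) X∩Y=∅ =
    _ , G ++ H , ++⁺ 𝒫 G∈ H∈
    , ++-disjoint G-disj H-disj (λ i j x p q → X∩Y=∅ x (proj₂ X≐ x (i , p)) (proj₂ Y≐ x (j , q)))
    , ≐-trans (∪-cong X≐ Y≐) (≐-sym (⋃-++ G H))

  ⋃-disjoint : ∀ {n} {F : Fin n → Subset Ω} →
               (∀ k → DisjointUnions 𝒫 (F k)) → PairwiseDisjoint F → DisjointUnions 𝒫 (⋃ F)
  ⋃-disjoint {ℕ.zero} {F} _ _ = respects ∅ (⋃ F) (≐-sym (⋃-[] F)) empty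
  ⋃-disjoint {ℕ.suc n} {F} F∈ F-disj =
    respects _ (⋃ F) (≐-sym (⋃-uncons F))
      (∪-disjoint (F∈ Fin.zero) (⋃-disjoint (λ k → F∈ (Fin.suc k)) (tail-disjoint F-disj))
        (λ { x p (k , q) → F-disj Fin.zero (Fin.suc k) (λ ()) x p q }))

  ⊑-ring : {ℛ : Collection Ω} → IsRing ℛ → 𝒫 ⊑ ℛ → DisjointUnions 𝒫 ⊑ ℛ
  ⊑-ring ring 𝒫⊑ℛ X (m , G , G∈ , _ , X≐) =
    IsRing.respects ring (⋃ G) X (≐-sym X≐) (⋃-closed ring (λ k → 𝒫⊑ℛ (G k) (G∈ k)))

  module _ (𝒫-∩ : ∀ {P Q} → 𝒫 P → 𝒫 Q → 𝒫 (P ∩ Q)) where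

    ∩-closedˡ : 𝒫 P → DisjointUnions 𝒫 Y → DisjointUnions 𝒫 (P ∩ Y)
    ∩-closedˡ {P} P∈ (n , H , H∈ , H-disj , Y≐) =
      n , (λ l → P ∩ H l) , (λ l → 𝒫-∩ P∈ (H∈ l)) , disjoint-⊆ H-disj (λ l _ → proj₂) , ∩-⋃ˡ Y≐

    ∩-closed : DisjointUnions 𝒫 X → DisjointUnions 𝒫 Y → DisjointUnions 𝒫 (X ∩ Y)
    ∩-closed (m , G , G∈ , G-disj , X≐) Y∈ =
      respects _ _ (≐-sym (∩-⋃ʳ X≐))
        (⋃-disjoint (λ k → ∩-closedˡ (G∈ k) Y∈) (disjoint-⊆ G-disj (λ k _ → proj₁)))

    module _ (𝒫-∖ : ∀ {P Q} → 𝒫 P → 𝒫 Q → DisjointUnions 𝒫 (P ∖ Q)) where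

      ∖-⋃-closed : ∀ {n} {H : Fin n → Subset Ω} →
                   𝒫 P → (∀ l → 𝒫 (H l)) → DisjointUnions 𝒫 (P ∖ ⋃ H)
      ∖-⋃-closed {P} {ℕ.zero} {H} P∈ _ =
        respects P (P ∖ ⋃ H) ((λ x p → p , proj₁ (⋃-[] H) x) , (λ _ → proj₁)) (singleton P∈)
      ∖-⋃-closed {P} {ℕ.suc n} {H} P∈ H∈ =
        respects _ _ (∖-⋃-uncons H)
          (∩-closed (𝒫-∖ P∈ (H∈ Fin.zero)) (∖-⋃-closed P∈ (λ l → H∈ (Fin.suc l))))

      ∖-closed : DisjointUnions 𝒫 X → DisjointUnions 𝒫 Y → DisjointUnions 𝒫 (X ∖ Y)
      ∖-closed (m , G , G∈ , G-disj , X≐) (n , H , H∈ , _ , Y≐) =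
        respects _ _ (≐-sym (∖-⋃ʳ X≐ Y≐))
          (⋃-disjoint (λ k → ∖-⋃-closed (G∈ k) H∈) (disjoint-⊆ G-disj (λ k _ → proj₁)))

      ∪-closed : ExcludedMiddle 0ℓ →
                 DisjointUnions 𝒫 X → DisjointUnions 𝒫 Y → DisjointUnions 𝒫 (X ∪ Y)
      ∪-closed em X∈ Y∈ =
        respects _ _ (∖-∪-cancel em) (∪-disjoint (∖-closed X∈ Y∈) Y∈ (λ x p → proj₂ p))

      isRing : ExcludedMiddle 0ℓ → IsRing (DisjointUnions 𝒫)
      isRing em = record
        { respects = respects
        ; empty    = empty
        ; union    = λ _ _ → ∪-closed em
        ; diff     = λ _ _ → ∖-closed
        }

module _ {Ω : Set} {𝒜 : Collection Ω} where

  DD-respects : RespectsEq (DD 𝒜)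
  DD-respects X Y X≐Y (A , n , F , A∈ , F∈ , F⊆A , F-disj , X≐) =
    A , n , F , A∈ , F∈ , F⊆A , F-disj , ≐-trans (≐-sym X≐Y) X≐

  ∈⇒DD : {A : Subset Ω} → 𝒜 A → DD 𝒜 A
  ∈⇒DD A∈ = _ , 0 , [] , A∈ , (λ ()) , (λ ()) , (λ ())
          , (λ x p → p , proj₁ (⋃-[] []) x) , (λ _ → proj₁)

  DD-⊑-ring : {ℛ : Collection Ω} → IsRing ℛ → 𝒜 ⊑ ℛ → DD 𝒜 ⊑ ℛ
  DD-⊑-ring ring 𝒜⊑ℛ X (A , _ , F , A∈ , F∈ , _ , _ , X≐) =
    respects _ X (≐-sym X≐) (diff A (⋃ F) (𝒜⊑ℛ A A∈) (⋃-closed ring (λ i → 𝒜⊑ℛ (F i) (F∈ i))))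
    where open IsRing ring

module DClass {Ω : Set} (em : ExcludedMiddle 0ℓ) {𝒜 : Collection Ω} (isD : IsDClass 𝒜) where

  open IsDClass isD

  private
    variable
      n : ℕ
      A B D X Y : Subset Ω

  ∩-closed : 𝒜 A → 𝒜 B → 𝒜 (A ∩ B)
  ∩-closed {A} {B} A∈ B∈ with em {NonEmpty (A ∩ B)}
  ... | yes A∩B≠∅ = inter A B A∈ B∈ A∩B≠∅
  ... | no A∩B=∅ = respects ∅ (A ∩ B) ((λ _ ()) , (λ x p → A∩B=∅ (x , p))) empty

  -- A subfamily is encoded by emptying the unselected members, which avoids reindexing.
  restrict : (Fin n → Set) → (Fin n → Subset Ω) → Fin n → Subset Ω
  restrict p F i x = p i × F i x

  restrict-closed : {p : Fin n → Set} {F : Fin n → Subset Ω} →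
                    (∀ i → 𝒜 (F i)) → ∀ i → 𝒜 (restrict p F i)
  restrict-closed {p = p} {F} F∈ i with em {p i}
  ... | yes pᵢ = respects (F i) _ ((λ _ q → pᵢ , q) , (λ _ → proj₂)) (F∈ i)
  ... | no ¬pᵢ = respects ∅ _ ((λ _ ()) , (λ _ q → ¬pᵢ (proj₁ q))) empty

  -- The selected members are absorbed one at a time; each meets the growing d set.
  ∪-⋃-meeting-closed : ∀ {n} {p : Fin n → Set} {F : Fin n → Subset Ω} →
    𝒜 D → (∀ i → 𝒜 (F i)) → (∀ i → p i → NonEmpty (F i ∩ D)) → 𝒜 (D ∪ ⋃ (restrict p F))
  ∪-⋃-meeting-closed {D} {ℕ.zero} {F = F} D∈ _ _ =
    respects D _ ((λ _ → inj₁) , (λ { _ (inj₁ q) → q ; _ (inj₂ (() , _)) })) D∈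
  ∪-⋃-meeting-closed {D} {ℕ.suc n} {p} {F} D∈ F∈ meets with em {p Fin.zero}
  ... | yes p₀ =
    respects _ _ (to , from)
      (∪-⋃-meeting-closed {p = tail p} D∪F₀∈ (λ i → F∈ (Fin.suc i)) meets-D∪F₀)
    where
    D∪F₀∈ : 𝒜 (D ∪ F Fin.zero)
    D∪F₀∈ = let (x , q , d) = meets Fin.zero p₀
            in union D (F Fin.zero) D∈ (F∈ Fin.zero) (x , d , q)
    meets-D∪F₀ : ∀ i → p (Fin.suc i) → NonEmpty (F (Fin.suc i) ∩ (D ∪ F Fin.zero))
    meets-D∪F₀ i pᵢ = let (x , q , d) = meets (Fin.suc i) pᵢ in x , q , inj₁ d
    to : ((D ∪ F Fin.zero) ∪ ⋃ (restrict (tail p) (tail F))) ⊆ (D ∪ ⋃ (restrict p F))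
    to _ (inj₁ (inj₁ d)) = inj₁ d
    to _ (inj₁ (inj₂ q)) = inj₂ (Fin.zero , p₀ , q)
    to _ (inj₂ (i , r)) = inj₂ (Fin.suc i , r)
    from : (D ∪ ⋃ (restrict p F)) ⊆ ((D ∪ F Fin.zero) ∪ ⋃ (restrict (tail p) (tail F)))
    from _ (inj₁ d) = inj₁ (inj₁ d)
    from _ (inj₂ (Fin.zero , _ , q)) = inj₁ (inj₂ q)
    from _ (inj₂ (Fin.suc i , r)) = inj₂ (i , r)
  ... | no ¬p₀ =
    respects _ _ (to , from)
      (∪-⋃-meeting-closed {p = tail p} D∈ (λ i → F∈ (Fin.suc i)) (λ i → meets (Fin.suc i)))
    where
    to : (D ∪ ⋃ (restrict (tail p) (tail F))) ⊆ (D ∪ ⋃ (restrict p F))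
    to _ (inj₁ d) = inj₁ d
    to _ (inj₂ (i , r)) = inj₂ (Fin.suc i , r)
    from : (D ∪ ⋃ (restrict p F)) ⊆ (D ∪ ⋃ (restrict (tail p) (tail F)))
    from _ (inj₁ d) = inj₁ d
    from _ (inj₂ (Fin.zero , p₀ , _)) = ⊥-elim (¬p₀ p₀)
    from _ (inj₂ (Fin.suc i , r)) = inj₂ (i , r)

  -- B₀ absorbs the members of the disjoint family for the tail that it meets.
  ⋃-disjointUnion : ∀ {k} {B : Fin k → Subset Ω} → (∀ i → 𝒜 (B i)) → DisjointUnions 𝒜 (⋃ B)
  ⋃-disjointUnion {ℕ.zero} {B} _ =
    DisjointUnionsOf.respects 𝒜 ∅ (⋃ B) (≐-sym (⋃-[] B)) (DisjointUnionsOf.empty 𝒜)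
  ⋃-disjointUnion {ℕ.suc k} {B} B∈ with ⋃-disjointUnion (λ i → B∈ (Fin.suc i))
  ... | n , F , F∈ , F-disj , (⋃B′⊆⋃F , ⋃F⊆⋃B′) =
    ℕ.suc n , C ∷ R , C∷R∈ , ∷-disjoint C-disj (disjoint-⊆ F-disj (λ _ _ → proj₂)) , to , from
    where
    meets : Fin n → Set
    meets i = NonEmpty (F i ∩ B Fin.zero)
    C : Subset Ω
    C = B Fin.zero ∪ ⋃ (restrict meets F)
    R : Fin n → Subset Ω
    R = restrict (¬_ ∘ meets) F
    C∷R∈ : ∀ i → 𝒜 ((C ∷ R) i)
    C∷R∈ Fin.zero = ∪-⋃-meeting-closed (B∈ Fin.zero) F∈ (λ _ m → m)
    C∷R∈ (Fin.suc i) = restrict-closed {p = ¬_ ∘ meets} F∈ i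
    C-disj : ∀ j → Disjoint C (R j)
    C-disj j x (inj₁ b) (¬mⱼ , q) = ¬mⱼ (x , q , b)
    C-disj j x (inj₂ (i , mᵢ , q)) (¬mⱼ , q′) with i ≟ j
    ... | yes refl = ¬mⱼ mᵢ
    ... | no i≢j = F-disj i j i≢j x q q′
    to : ⋃ B ⊆ ⋃ (C ∷ R)
    to x (Fin.zero , b) = Fin.zero , inj₁ b
    to x (Fin.suc i , b) with ⋃B′⊆⋃F x (i , b)
    ... | j , q with em {meets j}
    ... | yes mⱼ = Fin.zero , inj₂ (j , mⱼ , q)
    ... | no ¬mⱼ = Fin.suc j , ¬mⱼ , q
    from-F : ∀ j x → F j x → ⋃ B x
    from-F j x q = let (i , b) = ⋃F⊆⋃B′ x (j , q) in Fin.suc i , b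
    from : ⋃ (C ∷ R) ⊆ ⋃ B
    from x (Fin.zero , inj₁ b) = Fin.zero , b
    from x (Fin.zero , inj₂ (j , _ , q)) = from-F j x q
    from x (Fin.suc j , _ , q) = from-F j x q

  ∖-⋃-DD : ∀ {k} {B : Fin k → Subset Ω} → 𝒜 A → (∀ i → 𝒜 (B i)) → DD 𝒜 (A ∖ ⋃ B)
  ∖-⋃-DD {A} {B = B} A∈ B∈ with ⋃-disjointUnion (λ i → ∩-closed A∈ (B∈ i))
  ... | n , F , F∈ , F-disj , (⋃A∩B⊆⋃F , ⋃F⊆⋃A∩B) =
    A , n , F , A∈ , F∈ , F⊆A , F-disj , to , from
    where
    F⊆A : ∀ i → F i ⊆ A
    F⊆A i x q = proj₁ (proj₂ (⋃F⊆⋃A∩B x (i , q)))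
    to : (A ∖ ⋃ B) ⊆ (A ∖ ⋃ F)
    to x (a , ∉B) = a , λ q → let (i , _ , b) = ⋃F⊆⋃A∩B x q in ∉B (i , b)
    from : (A ∖ ⋃ F) ⊆ (A ∖ ⋃ B)
    from x (a , ∉F) = a , λ { (i , b) → ∉F (⋃A∩B⊆⋃F x (i , a , b)) }

  DD-∩ : DD 𝒜 X → DD 𝒜 Y → DD 𝒜 (X ∩ Y)
  DD-∩ {X} {Y} (A , _ , F , A∈ , F∈ , _ , _ , X≐) (B , _ , E , B∈ , E∈ , _ , _ , Y≐) =
    DD-respects _ _ (≐-sym X∩Y≐) (∖-⋃-DD (∩-closed A∈ B∈) (++⁺ 𝒜 F∈ E∈))
    where
    X∩Y≐ : (X ∩ Y) ≐ ((A ∩ B) ∖ ⋃ (F ++ E))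
    X∩Y≐ = ≐-trans (∩-cong X≐ Y≐) (≐-trans ∖-∩-∖ (∖-cong ≐-refl (≐-sym (⋃-++ F E))))

  DD-∖ : DD 𝒜 X → DD 𝒜 Y → DisjointUnions (DD 𝒜) (X ∖ Y)
  DD-∖ {X} {Y} X∈@(A , _ , F , A∈ , F∈ , _ , _ , X≐) (B , _ , E , B∈ , E∈ , E⊆B , E-disj , Y≐) =
    DDD-respects _ _ (≐-sym X∖Y≐)
      (∪-disjoint (singleton X∖B∈) (∩-closedˡ DD-∩ X∈ ⋃E∈)
        λ { x (_ , ∉B) (_ , k , e) → ∉B (E⊆B k x e) })
    where
    open DisjointUnionsOf (DD 𝒜)
      using (∪-disjoint; singleton; ∩-closedˡ) renaming (respects to DDD-respects)
    X∖Y≐ : (X ∖ Y) ≐ ((X ∖ B) ∪ (X ∩ ⋃ E))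
    X∖Y≐ = ≐-trans (∖-cong ≐-refl Y≐) (∖-∖ em (λ x (k , e) → E⊆B k x e))
    X∖B∈ : DD 𝒜 (X ∖ B)
    X∖B∈ = DD-respects _ _ (≐-sym (≐-trans (∖-cong X≐ ≐-refl) ∖-⋃-∷))
             (∖-⋃-DD A∈ λ { Fin.zero → B∈ ; (Fin.suc i) → F∈ i })
    ⋃E∈ : DisjointUnions (DD 𝒜) (⋃ E)
    ⋃E∈ = _ , E , (λ k → ∈⇒DD (E∈ k)) , E-disj , ≐-refl

  isRing : IsRing (DDD 𝒜)
  isRing = DisjointUnionsOf.isRing (DD 𝒜) DD-∩ DD-∖ em

mainTheorem19 : ExcludedMiddle (suc zero) → (Ω : Set) → (𝒜 : Collection Ω) → IsDClass 𝒜
    → IsRing (DDD 𝒜) × IsGeneratedRing 𝒜 (DDD 𝒜)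
mainTheorem19 em Ω 𝒜 isD =
  isRing , isRing , (λ A A∈ → DisjointUnionsOf.singleton (DD 𝒜) (∈⇒DD A∈)) ,
  λ ℛ ℛ-ring 𝒜⊑ℛ → DisjointUnionsOf.⊑-ring (DD 𝒜) ℛ-ring (DD-⊑-ring ℛ-ring 𝒜⊑ℛ)
  where open DClass (lowerExcludedMiddle em) isD
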